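{- The Lie bracket $\{ -,-\}_A$ preserves the subspace $\mathfrak{Lie}(b_1,b_2,\dots)\subset\mathfrak{Lie}(B)$, i.e. $\{\psi_1,\psi_2\}_A\in\mathfrak{Lie}(b_1,b_2,\dots)$ whenever $\psi_1,\psi_2\in\mathfrak{Lie}(b_1,b_2,\dots)$.
   Context: Let $B=\{b_0,b_1,b_2,\dots\}$, $\mathbb{Q}\langle B\rangle$ the free associative $\mathbb{Q}$-algebra on $B$, $\mathfrak{Lie}(B)\subset\mathbb{Q}\langle B\rangle$ the free Lie algebra on $B$, and $\mathfrak{Lie}(b_1,b_2,\dots)$ the Lie subalgebra generated by $b_1,b_2,\dots$. For a word $w=b_0^{m_1}b_{k_1}\cdots b_0^{m_d}b_{k_d}b_0^{m_{d+1}}$ ($d\ge1$, $k_i\ge1$, $m_i\ge0$), $\mathbf{k}=(k_1,\dots,k_d)$ and $\mathbf{l}\in\mathbb{Z}_{>0}^d$, let $w(\mathbf{l})$ be obtained by replacing each $b_{k_i}$ by $b_{l_i}$, $|\mathbf{k}|=\sum k_i$, $\binom{\mathbf{k}-1}{\mathbf{l}-1}=\prod_i\binom{k_i-1}{l_i-1}$, $\mathbf{l}\le\mathbf{k}$ componentwise. Let $\partial_w$ be the derivation of $\mathbb{Q}\langle B\rangle$ with $\partial_w(b_0)=0$ and $\partial_w(b_i)=\sum_{\mathbf{l}\le\mathbf{k}}(-1)^{|\mathbf{k}|+|\mathbf{l}|}\binom{\mathbf{k}-1}{\mathbf{l}-1}[b_{i+|\mathbf{k}|-|\mathbf{l}|},w(\mathbf{l})]$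 for $i\ge1$; if $w=b_0^m$ ($m\ge1$), $\partial_w(b_0)=0$, $\partial_w(b_i)=[b_i,w]$; extend linearly in $w$. The Lie bracket on $\mathfrak{Lie}(B)$ is $\{\psi_1,\psi_2\}_A=\partial_{\psi_1}(\psi_2)-\partial_{\psi_2}(\psi_1)+[\psi_1,\psi_2]$. -}

module Defs where

open import Data.Nat as ℕ using (ℕ; zero; suc)
open import Data.Nat.Combinatorics using (_C_)
open import Data.Integer using (+_)
open import Data.Rational as ℚ using (ℚ; 0ℚ; 1ℚ; -_)
open import Data.List using (List; []; _∷_; _++_; map; concatMap; foldr; upTo)
open import Data.List.Properties using (≡-dec)
open import Data.Product using (_×_; _,_; Σ)
open import Relation.Nullary using (yes; no)
open import Relation.Binary.PropositionalEquality using (_≡_)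

-- The letter b_i is represented by the natural number i.
Word : Set
Word = List ℕ

-- An element of ℚ⟨B⟩ as a finite formal sum of (coefficient , word).
Poly : Set
Poly = List (ℚ × Word)

coeff : Poly → Word → ℚ
coeff [] w = 0ℚ
coeff ((c , v) ∷ p) w with ≡-dec ℕ._≟_ v w
... | yes _ = c ℚ.+ coeff p w
... | no  _ = coeff p w

_≈ₚ_ : Poly → Poly → Set
p ≈ₚ q = ∀ w → coeff p w ≡ coeff q w

mono : Word → Poly
mono w = (1ℚ , w) ∷ []

letter : ℕ → Poly
letter i = mono (i ∷ [])

_+ₚ_ : Poly → Poly → Poly
p +ₚ q = p ++ q

_•_ : ℚ → Poly → Poly
c • p = map (λ { (d , w) → (c ℚ.* d , w) }) p

-ₚ_ : Poly → Poly
-ₚ p = (- 1ℚ) • p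

_*ₚ_ : Poly → Poly → Poly
p *ₚ q = concatMap (λ { (c , v) → map (λ { (d , w) → (c ℚ.* d , v ++ w) }) q }) p

⟦_,_⟧ : Poly → Poly → Poly
⟦ p , q ⟧ = (p *ₚ q) +ₚ (-ₚ (q *ₚ p))

ℕtoℚ : ℕ → ℚ
ℕtoℚ n = + n ℚ./ 1

sign : ℕ → ℚ
sign zero = 1ℚ
sign (suc n) = - sign n

-- For w = b_0^{m_1} b_{k_1} ... b_{k_d} b_0^{m_{d+1}}, the list of all
-- ( (-1)^{|k|+|l|} binom(k-1,l-1) , |k| - |l| , w(l) )  for 1 ≤ l ≤ k.
subs : Word → List (ℚ × ℕ × Word)
subs [] = (1ℚ , 0 , []) ∷ []
subs (zero ∷ w) = map (λ { (c , δ , v) → (c , δ , zero ∷ v) }) (subs w)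
subs (suc k ∷ w) =
  concatMap (λ l → map (λ { (c , δ , v) →
      (sign (k ℕ.∸ l) ℚ.* ℕtoℚ (k C l) ℚ.* c , (k ℕ.∸ l) ℕ.+ δ , suc l ∷ v) })
    (subs w)) (upTo (suc k))

-- ∂_w on generators: ∂_w(b_0) = 0,
-- ∂_w(b_i) = Σ_{l ≤ k} (-1)^{|k|+|l|} binom(k-1,l-1) [b_{i+|k|-|l|}, w(l)]  (i ≥ 1).
-- (For w = b_0^m this sum is the single term [b_i , w], as in the paper.)
∂gen : Word → ℕ → Poly
∂gen w zero = []
∂gen w (suc i) = concatMap (λ { (c , δ , v) → c • ⟦ letter (suc i ℕ.+ δ) , mono v ⟧ }) (subs w)

derWord : (ℕ → Poly) → Word → Poly
derWord D [] = []
derWord D (x ∷ xs) = (D x *ₚ mono xs) +ₚ (letter x *ₚ derWord D xs)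

derPoly : (ℕ → Poly) → Poly → Poly
derPoly D p = concatMap (λ { (c , w) → c • derWord D w }) p

∂ : Poly → Poly → Poly
∂ ψ x = concatMap (λ { (c , w) → c • derPoly (∂gen w) x }) ψ

bracketA : Poly → Poly → Poly
bracketA ψ₁ ψ₂ = (∂ ψ₁ ψ₂ +ₚ (-ₚ ∂ ψ₂ ψ₁)) +ₚ ⟦ ψ₁ , ψ₂ ⟧

data LieExpr : Set where
  gen  : ℕ → LieExpr              -- gen n stands for b_{n+1}
  zer  : LieExpr
  add  : LieExpr → LieExpr → LieExpr
  smul : ℚ → LieExpr → LieExpr
  br   : LieExpr → LieExpr → LieExpr

evalL : LieExpr → Poly
evalL (gen n) = letter (suc n)
evalL zer = []
evalL (add e f) = evalL e +ₚ evalL f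
evalL (smul c e) = c • evalL e
evalL (br e f) = ⟦ evalL e , evalL f ⟧

InLie⁺ : Poly → Set
InLie⁺ p = Σ LieExpr (λ e → evalL e ≈ₚ p)

{-# OPTIONS --safe #-}

-- For a word w, ∂_w(b_{n+1}) = Σ c [b_{n+1+δ}, v], the sum running over the terms c t^δ v of Φ(w),
-- where Φ : ℚ⟨B⟩ → ℚ⟨B⟩[t] is the algebra homomorphism fixing b_0 and sending b_{k+1} to
-- Σ_{l ≤ k} (-1)^{k-l} binom(k,l) t^{k-l} b_{l+1}.  Being a homomorphism that maps b_1, b_2, …
-- into 𝔏𝔦𝔢(b_1, b_2, …)[t], Φ maps all of 𝔏𝔦𝔢(b_1, b_2, …) there.  As ∂_ψ is linear in ψ, for
-- ψ ∈ 𝔏𝔦𝔢(b_1, b_2, …) each ∂_ψ(b_{n+1}) is then a combination of brackets [b_m, ξ] with ξ Lie,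
-- and a derivation sending b_1, b_2, … into 𝔏𝔦𝔢(b_1, b_2, …) preserves 𝔏𝔦𝔢(b_1, b_2, …).
-- So ∂_ψ₁ ψ₂, ∂_ψ₂ ψ₁ and [ψ₁, ψ₂] are Lie.

module Submission where

open import Defs hiding (coeff)

open import Algebra.Structures using (IsMonoid)
open import Data.List using (List; []; _∷_; _++_; map; concatMap; length; upTo)
open import Data.List.Instances using (List-≡-isDecEquivalence)
open import Data.List.Properties
  using (++-isMonoid; ++-assoc; ++-identityʳ; concatMap-++; map-++; map-cong)
open import Data.Nat as ℕ using (ℕ; zero; suc; _∸_; _≤_; z≤n; s≤s)
open import Data.Nat.Combinatorics using (_C_)
open import Data.Nat.Instances using (ℕ-≡-isDecEquivalence)
import Data.Nat.Properties as ℕ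
open import Data.Product using (_×_; _,_)
open import Data.Product.Instances using (Σ-≡-isDecEquivalence)
open import Data.Rational using (ℚ; 0ℚ; 1ℚ; _+_; _*_; -_)
import Data.Rational.Properties as ℚ
open import Data.Rational.Solver using (module +-*-Solver)
open import Level using (0ℓ)
open import Relation.Binary.Bundles using (Setoid)
open import Relation.Binary.PropositionalEquality
  using (_≡_; refl; sym; trans; cong; cong₂; isEquivalence; module ≡-Reasoning)
import Relation.Binary.Reasoning.Setoid as SetoidReasoning
open import Relation.Binary.TypeClasses using (IsDecEquivalence; _≟_)
open import Relation.Nullary using (yes; no; ¬_; contradiction)

open +-*-Solver using (solve; _:=_; _:+_; _:*_; con)

private
  variable
    K M : Set

-- Formal sums

-- _·_, _⋆_ and extend below are written exactly like Defs' _•_, _*ₚ_ and derPoly, so on words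
-- they coincide with them definitionally.
FormalSum : Set → Set
FormalSum K = List (ℚ × K)

module _ {K : Set} where

  single : K → FormalSum K
  single k = (1ℚ , k) ∷ []

  infixr 8 _·_
  _·_ : ℚ → FormalSum K → FormalSum K
  c · p = map (λ { (d , k) → (c * d , k) }) p

  pairing : (K → ℚ) → FormalSum K → ℚ
  pairing f []            = 0ℚ
  pairing f ((c , k) ∷ p) = c * f k + pairing f p

  pairing-++ : ∀ f p q → pairing f (p ++ q) ≡ pairing f p + pairing f q
  pairing-++ f []            q = sym (ℚ.+-identityˡ _)
  pairing-++ f ((c , k) ∷ p) q = begin
    c * f k + pairing f (p ++ q)           ≡⟨ cong (c * f k +_) (pairing-++ f p q) ⟩
    c * f k + (pairing f p + pairing f q)  ≡⟨ ℚ.+-assoc (c * f k) _ _ ⟨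
    c * f k + pairing f p + pairing f q    ∎
    where open ≡-Reasoning

  pairing-· : ∀ f c p → pairing f (c · p) ≡ c * pairing f p
  pairing-· f c []            = sym (ℚ.*-zeroʳ c)
  pairing-· f c ((d , k) ∷ p) = begin
    c * d * f k + pairing f (c · p)
      ≡⟨ cong (c * d * f k +_) (pairing-· f c p) ⟩
    c * d * f k + c * pairing f p
      ≡⟨ solve 4 (λ c d x y → c :* d :* x :+ c :* y := c :* (d :* x :+ y)) refl c d (f k) (pairing f p) ⟩
    c * (d * f k + pairing f p)
      ∎
    where open ≡-Reasoning

  pairing-cong : ∀ {f g} → (∀ k → f k ≡ g k) → ∀ p → pairing f p ≡ pairing g p
  pairing-cong f≗g []            = refl
  pairing-cong f≗g ((c , k) ∷ p) = cong₂ (λ x y → c * x + y) (f≗g k) (pairing-cong f≗g p)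

  pairing-0 : ∀ p → pairing (λ _ → 0ℚ) p ≡ 0ℚ
  pairing-0 []            = refl
  pairing-0 ((c , k) ∷ p) = trans (cong₂ _+_ (ℚ.*-zeroʳ c) (pairing-0 p)) (ℚ.+-identityˡ 0ℚ)

  pairing-+ : ∀ f g p → pairing (λ k → f k + g k) p ≡ pairing f p + pairing g p
  pairing-+ f g []            = sym (ℚ.+-identityˡ 0ℚ)
  pairing-+ f g ((c , k) ∷ p) = begin
    c * (f k + g k) + pairing (λ k → f k + g k) p
      ≡⟨ cong (c * (f k + g k) +_) (pairing-+ f g p) ⟩
    c * (f k + g k) + (pairing f p + pairing g p)
      ≡⟨ solve 5 (λ c x y u v → c :* (x :+ y) :+ (u :+ v) := (c :* x :+ u) :+ (c :* y :+ v)) refl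
                 c (f k) (g k) (pairing f p) (pairing g p) ⟩
    (c * f k + pairing f p) + (c * g k + pairing g p)
      ∎
    where open ≡-Reasoning

  pairing-* : ∀ c f p → pairing (λ k → c * f k) p ≡ c * pairing f p
  pairing-* c f []            = sym (ℚ.*-zeroʳ c)
  pairing-* c f ((d , k) ∷ p) = begin
    d * (c * f k) + pairing (λ k → c * f k) p
      ≡⟨ cong (d * (c * f k) +_) (pairing-* c f p) ⟩
    d * (c * f k) + c * pairing f p
      ≡⟨ solve 4 (λ d c x u → d :* (c :* x) :+ c :* u := c :* (d :* x :+ u)) refl d c (f k) (pairing f p) ⟩
    c * (d * f k + pairing f p)
      ∎
    where open ≡-Reasoning

pairing-swap : ∀ (h : K → M → ℚ) p q →
               pairing (λ k → pairing (h k) q) p ≡ pairing (λ m → pairing (λ k → h k m) p) q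
pairing-swap h []            q = sym (pairing-0 q)
pairing-swap h ((c , k) ∷ p) q = begin
  c * pairing (h k) q + pairing (λ k → pairing (h k) q) p
    ≡⟨ cong₂ _+_ (sym (pairing-* c (h k) q)) (pairing-swap h p q) ⟩
  pairing (λ m → c * h k m) q + pairing (λ m → pairing (λ k → h k m) p) q
    ≡⟨ pairing-+ _ _ q ⟨
  pairing (λ m → c * h k m + pairing (λ k → h k m) p) q
    ∎
  where open ≡-Reasoning

module _ {K : Set} {{_ : IsDecEquivalence {A = K} _≡_}} where

  coeff : FormalSum K → K → ℚ
  coeff []            k = 0ℚ
  coeff ((c , l) ∷ p) k with l ≟ k
  ... | yes _ = c + coeff p k
  ... | no  _ = coeff p k

  infix 4 _≈_
  record _≈_ (p q : FormalSum K) : Set where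
    constructor mk≈
    field coeff-≡ : ∀ k → coeff p k ≡ coeff q k
  open _≈_ public

  ≈-setoid : Setoid 0ℓ 0ℓ
  ≈-setoid = record
    { Carrier       = FormalSum K
    ; _≈_           = _≈_
    ; isEquivalence = record
      { refl  = mk≈ λ _ → refl
      ; sym   = λ p≈q → mk≈ λ k → sym (coeff-≡ p≈q k)
      ; trans = λ p≈q q≈r → mk≈ λ k → trans (coeff-≡ p≈q k) (coeff-≡ q≈r k)
      }
    }

  open Setoid ≈-setoid public
    using () renaming (refl to ≈-refl; sym to ≈-sym; trans to ≈-trans; reflexive to ≈-reflexive)

  coeff-++ : ∀ p q k → coeff (p ++ q) k ≡ coeff p k + coeff q k
  coeff-++ []            q k = sym (ℚ.+-identityˡ _)
  coeff-++ ((c , l) ∷ p) q k with l ≟ k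
  ... | yes _ = trans (cong (c +_) (coeff-++ p q k)) (sym (ℚ.+-assoc c _ _))
  ... | no  _ = coeff-++ p q k

  coeff-· : ∀ c p k → coeff (c · p) k ≡ c * coeff p k
  coeff-· c []            k = sym (ℚ.*-zeroʳ c)
  coeff-· c ((d , l) ∷ p) k with l ≟ k
  ... | yes _ = trans (cong (c * d +_) (coeff-· c p k)) (sym (ℚ.*-distribˡ-+ c d _))
  ... | no  _ = coeff-· c p k

  ++-cong : ∀ {p p′ q q′} → p ≈ p′ → q ≈ q′ → p ++ q ≈ p′ ++ q′
  ++-cong {p} {p′} {q} {q′} p≈p′ q≈q′ = mk≈ λ k → begin
    coeff (p ++ q) k         ≡⟨ coeff-++ p q k ⟩
    coeff p k + coeff q k    ≡⟨ cong₂ _+_ (coeff-≡ p≈p′ k) (coeff-≡ q≈q′ k) ⟩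
    coeff p′ k + coeff q′ k  ≡⟨ coeff-++ p′ q′ k ⟨
    coeff (p′ ++ q′) k       ∎
    where open ≡-Reasoning

  ++-congʳ : ∀ p {q q′} → q ≈ q′ → p ++ q ≈ p ++ q′
  ++-congʳ p = ++-cong (≈-refl {x = p})

  ·-cong : ∀ c {p q} → p ≈ q → c · p ≈ c · q
  ·-cong c {p} {q} p≈q = mk≈ λ k → begin
    coeff (c · p) k  ≡⟨ coeff-· c p k ⟩
    c * coeff p k    ≡⟨ cong (c *_) (coeff-≡ p≈q k) ⟩
    c * coeff q k    ≡⟨ coeff-· c q k ⟨
    coeff (c · q) k  ∎
    where open ≡-Reasoning

  ++-comm : ∀ p q → p ++ q ≈ q ++ p
  ++-comm p q = mk≈ λ k → begin
    coeff (p ++ q) k       ≡⟨ coeff-++ p q k ⟩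
    coeff p k + coeff q k  ≡⟨ ℚ.+-comm (coeff p k) (coeff q k) ⟩
    coeff q k + coeff p k  ≡⟨ coeff-++ q p k ⟨
    coeff (q ++ p) k       ∎
    where open ≡-Reasoning

  ++-interchange : ∀ p q r s → (p ++ q) ++ (r ++ s) ≈ (p ++ r) ++ (q ++ s)
  ++-interchange p q r s = mk≈ λ k → begin
    coeff ((p ++ q) ++ (r ++ s)) k
      ≡⟨ coeff-++-++ p q r s k ⟩
    (coeff p k + coeff q k) + (coeff r k + coeff s k)
      ≡⟨ solve 4 (λ a b c d → (a :+ b) :+ (c :+ d) := (a :+ c) :+ (b :+ d)) refl
                 (coeff p k) (coeff q k) (coeff r k) (coeff s k) ⟩
    (coeff p k + coeff r k) + (coeff q k + coeff s k)
      ≡⟨ coeff-++-++ p r q s k ⟨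
    coeff ((p ++ r) ++ (q ++ s)) k
      ∎
    where
    open ≡-Reasoning
    coeff-++-++ : ∀ p q r s k →
                  coeff ((p ++ q) ++ (r ++ s)) k ≡ (coeff p k + coeff q k) + (coeff r k + coeff s k)
    coeff-++-++ p q r s k =
      trans (coeff-++ (p ++ q) (r ++ s) k) (cong₂ _+_ (coeff-++ p q k) (coeff-++ r s k))

  pairing-coeff-single : ∀ k p → pairing (λ l → coeff (single l) k) p ≡ coeff p k
  pairing-coeff-single k []            = refl
  pairing-coeff-single k ((c , l) ∷ p) with l ≟ k
  ... | yes _ = cong₂ _+_ (trans (cong (c *_) (ℚ.+-identityʳ 1ℚ)) (ℚ.*-identityʳ c))
                          (pairing-coeff-single k p)
  ... | no  _ = trans (cong (_+ _) (ℚ.*-zeroʳ c)) (trans (ℚ.+-identityˡ _) (pairing-coeff-single k p))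

  remove : K → FormalSum K → FormalSum K
  remove k []            = []
  remove k ((c , l) ∷ p) with l ≟ k
  ... | yes _ = remove k p
  ... | no  _ = (c , l) ∷ remove k p

  length-remove : ∀ k p → length (remove k p) ≤ length p
  length-remove k []            = z≤n
  length-remove k ((c , l) ∷ p) with l ≟ k
  ... | yes _ = ℕ.m≤n⇒m≤1+n (length-remove k p)
  ... | no  _ = s≤s (length-remove k p)

  length-remove-head : ∀ c k p → length (remove k ((c , k) ∷ p)) ≤ length p
  length-remove-head c k p with k ≟ k
  ... | yes _   = length-remove k p
  ... | no  k≢k = contradiction refl k≢k

  coeff-remove-≡ : ∀ k p → coeff (remove k p) k ≡ 0ℚ
  coeff-remove-≡ k []            = refl
  coeff-remove-≡ k ((c , l) ∷ p) with l ≟ k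
  ... | yes _ = coeff-remove-≡ k p
  ... | no l≢k with l ≟ k
  ...   | yes l≡k = contradiction l≡k l≢k
  ...   | no  _   = coeff-remove-≡ k p

  coeff-remove-≢ : ∀ k p {l} → ¬ l ≡ k → coeff (remove k p) l ≡ coeff p l
  coeff-remove-≢ k []            l≢k = refl
  coeff-remove-≢ k ((c , m) ∷ p) {l} l≢k with m ≟ k
  ... | yes refl with k ≟ l
  ...   | yes refl = contradiction refl l≢k
  ...   | no  _    = coeff-remove-≢ k p l≢k
  coeff-remove-≢ k ((c , m) ∷ p) {l} l≢k | no _ with m ≟ l
  ...   | yes _ = cong (c +_) (coeff-remove-≢ k p l≢k)
  ...   | no  _ = coeff-remove-≢ k p l≢k

  pairing-remove : ∀ f k p → pairing f p ≡ coeff p k * f k + pairing f (remove k p)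
  pairing-remove f k []            = sym (trans (cong (_+ 0ℚ) (ℚ.*-zeroˡ (f k))) (ℚ.+-identityˡ 0ℚ))
  pairing-remove f k ((c , l) ∷ p) with l ≟ k
  ... | yes refl = trans (cong (c * f l +_) (pairing-remove f l p))
    (solve 4 (λ c a x r → c :* x :+ (a :* x :+ r) := (c :+ a) :* x :+ r) refl
             c (coeff p l) (f l) (pairing f (remove l p)))
  ... | no  _    = trans (cong (c * f l +_) (pairing-remove f k p))
    (solve 5 (λ c y a x r → c :* y :+ (a :* x :+ r) := a :* x :+ (c :* y :+ r)) refl
             c (f l) (coeff p k) (f k) (pairing f (remove k p)))

  pairing-null : ∀ f p → (∀ k → coeff p k ≡ 0ℚ) → pairing f p ≡ 0ℚ
  pairing-null f p = go (length p) p ℕ.≤-refl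
    where
    go : ∀ n p → length p ≤ n → (∀ k → coeff p k ≡ 0ℚ) → pairing f p ≡ 0ℚ
    go _       []            _           _    = refl
    go (suc n) ((c , k) ∷ p) (s≤s |p|≤n) null = begin
      pairing f ((c , k) ∷ p)
        ≡⟨ pairing-remove f k ((c , k) ∷ p) ⟩
      coeff ((c , k) ∷ p) k * f k + pairing f p′
        ≡⟨ cong₂ (λ x y → x * f k + y) (null k)
                 (go n p′ (ℕ.≤-trans (length-remove-head c k p) |p|≤n) null′) ⟩
      0ℚ * f k + 0ℚ
        ≡⟨ trans (ℚ.+-identityʳ _) (ℚ.*-zeroˡ (f k)) ⟩
      0ℚ
        ∎
      where
      open ≡-Reasoning
      p′ = remove k ((c , k) ∷ p)
      null′ : ∀ l → coeff p′ l ≡ 0ℚ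
      null′ l with l ≟ k
      ... | yes refl = coeff-remove-≡ k ((c , k) ∷ p)
      ... | no  l≢k  = trans (coeff-remove-≢ k ((c , k) ∷ p) l≢k) (null l)

  pairing-resp : ∀ f {p q} → p ≈ q → pairing f p ≡ pairing f q
  pairing-resp f {p} {q} p≈q = begin
    pairing f p
      ≡⟨ solve 2 (λ a b → a := (a :+ con (- 1ℚ) :* b) :+ b) refl (pairing f p) (pairing f q) ⟩
    (pairing f p + - 1ℚ * pairing f q) + pairing f q
      ≡⟨ cong (_+ pairing f q) difference-null ⟩
    0ℚ + pairing f q
      ≡⟨ ℚ.+-identityˡ _ ⟩
    pairing f q
      ∎
    where
    open ≡-Reasoning
    difference-null : pairing f p + - 1ℚ * pairing f q ≡ 0ℚ
    difference-null = begin
      pairing f p + - 1ℚ * pairing f q      ≡⟨ cong (pairing f p +_) (pairing-· f (- 1ℚ) q) ⟨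
      pairing f p + pairing f ((- 1ℚ) · q)  ≡⟨ pairing-++ f p ((- 1ℚ) · q) ⟨
      pairing f (p ++ (- 1ℚ) · q)           ≡⟨ pairing-null f (p ++ (- 1ℚ) · q) (λ k → begin
        coeff (p ++ (- 1ℚ) · q) k             ≡⟨ coeff-++ p _ k ⟩
        coeff p k + coeff ((- 1ℚ) · q) k      ≡⟨ cong₂ _+_ (coeff-≡ p≈q k) (coeff-· (- 1ℚ) q k) ⟩
        coeff q k + - 1ℚ * coeff q k          ≡⟨ solve 1 (λ b → b :+ con (- 1ℚ) :* b := con 0ℚ) refl (coeff q k) ⟩
        0ℚ                                    ∎) ⟩
      0ℚ                                    ∎
-- Linear extension

extend : {L : Set} → (K → FormalSum L) → FormalSum K → FormalSum L
extend F = concatMap (λ { (c , k) → c · F k })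

module _ {L : Set} {{_ : IsDecEquivalence {A = L} _≡_}} where

  coeff-extend : ∀ (F : K → FormalSum L) p l → coeff (extend F p) l ≡ pairing (λ k → coeff (F k) l) p
  coeff-extend F []            l = refl
  coeff-extend F ((c , k) ∷ p) l =
    trans (coeff-++ (c · F k) (extend F p) l) (cong₂ _+_ (coeff-· c (F k) l) (coeff-extend F p l))

  extend-resp : {{_ : IsDecEquivalence {A = K} _≡_}} →
                ∀ (F : K → FormalSum L) {p q} → p ≈ q → extend F p ≈ extend F q
  extend-resp F {p} {q} p≈q = mk≈ λ l → begin
    coeff (extend F p) l             ≡⟨ coeff-extend F p l ⟩
    pairing (λ k → coeff (F k) l) p  ≡⟨ pairing-resp _ p≈q ⟩
    pairing (λ k → coeff (F k) l) q  ≡⟨ coeff-extend F q l ⟨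
    coeff (extend F q) l             ∎
    where open ≡-Reasoning

  extend-cong : ∀ {F G : K → FormalSum L} → (∀ k → F k ≈ G k) → ∀ p → extend F p ≈ extend G p
  extend-cong {F = F} {G = G} F≈G p = mk≈ λ l → begin
    coeff (extend F p) l             ≡⟨ coeff-extend F p l ⟩
    pairing (λ k → coeff (F k) l) p  ≡⟨ pairing-cong (λ k → coeff-≡ (F≈G k) l) p ⟩
    pairing (λ k → coeff (G k) l) p  ≡⟨ coeff-extend G p l ⟨
    coeff (extend G p) l             ∎
    where open ≡-Reasoning

  extend-· : ∀ (F : K → FormalSum L) c p → extend F (c · p) ≈ c · extend F p
  extend-· F c p = mk≈ λ l → begin
    coeff (extend F (c · p)) l             ≡⟨ coeff-extend F (c · p) l ⟩
    pairing (λ k → coeff (F k) l) (c · p)  ≡⟨ pairing-· _ c p ⟩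
    c * pairing (λ k → coeff (F k) l) p    ≡⟨ cong (c *_) (coeff-extend F p l) ⟨
    c * coeff (extend F p) l               ≡⟨ coeff-· c (extend F p) l ⟨
    coeff (c · extend F p) l               ∎
    where open ≡-Reasoning

  extend-single : ∀ (F : K → FormalSum L) k → extend F (single k) ≈ F k
  extend-single F k = mk≈ λ l →
    trans (coeff-extend F (single k) l) (trans (ℚ.+-identityʳ _) (ℚ.*-identityˡ _))

  extend-++ᶠ : ∀ (F G : K → FormalSum L) p → extend (λ k → F k ++ G k) p ≈ extend F p ++ extend G p
  extend-++ᶠ F G p = mk≈ λ l → begin
    coeff (extend (λ k → F k ++ G k) p) l
      ≡⟨ coeff-extend _ p l ⟩
    pairing (λ k → coeff (F k ++ G k) l) p
      ≡⟨ pairing-cong (λ k → coeff-++ (F k) (G k) l) p ⟩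
    pairing (λ k → coeff (F k) l + coeff (G k) l) p
      ≡⟨ pairing-+ _ _ p ⟩
    pairing (λ k → coeff (F k) l) p + pairing (λ k → coeff (G k) l) p
      ≡⟨ cong₂ _+_ (coeff-extend F p l) (coeff-extend G p l) ⟨
    coeff (extend F p) l + coeff (extend G p) l
      ≡⟨ coeff-++ (extend F p) _ l ⟨
    coeff (extend F p ++ extend G p) l
      ∎
    where open ≡-Reasoning

  extend-·ᶠ : ∀ c (F : K → FormalSum L) p → extend (λ k → c · F k) p ≈ c · extend F p
  extend-·ᶠ c F p = mk≈ λ l → begin
    coeff (extend (λ k → c · F k) p) l   ≡⟨ coeff-extend _ p l ⟩
    pairing (λ k → coeff (c · F k) l) p  ≡⟨ pairing-cong (λ k → coeff-· c (F k) l) p ⟩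
    pairing (λ k → c * coeff (F k) l) p  ≡⟨ pairing-* c _ p ⟩
    c * pairing (λ k → coeff (F k) l) p  ≡⟨ cong (c *_) (coeff-extend F p l) ⟨
    c * coeff (extend F p) l             ≡⟨ coeff-· c (extend F p) l ⟨
    coeff (c · extend F p) l             ∎
    where open ≡-Reasoning

  extend-[]ᶠ : ∀ (p : FormalSum K) → extend (λ _ → []) p ≈ []
  extend-[]ᶠ p = mk≈ λ l → trans (coeff-extend (λ _ → []) p l) (pairing-0 p)

  extend-extend : ∀ (F : M → FormalSum L) (G : K → FormalSum M) p →
                  extend F (extend G p) ≈ extend (λ k → extend F (G k)) p
  extend-extend F G []            = ≈-refl
  extend-extend F G ((c , k) ∷ p) = begin
    extend F (c · G k ++ extend G p)                       ≡⟨ concatMap-++ _ (c · G k) (extend G p) ⟩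
    extend F (c · G k) ++ extend F (extend G p)            ≈⟨ ++-cong (extend-· F c (G k)) (extend-extend F G p) ⟩
    c · extend F (G k) ++ extend (λ k → extend F (G k)) p  ∎
    where open SetoidReasoning ≈-setoid

  extend-swap : ∀ (H : K → M → FormalSum L) p q →
                extend (λ k → extend (H k) q) p ≈ extend (λ m → extend (λ k → H k m) p) q
  extend-swap H p q = mk≈ λ l → begin
    coeff (extend (λ k → extend (H k) q) p) l
      ≡⟨ coeff-extend _ p l ⟩
    pairing (λ k → coeff (extend (H k) q) l) p
      ≡⟨ pairing-cong (λ k → coeff-extend (H k) q l) p ⟩
    pairing (λ k → pairing (λ m → coeff (H k m) l) q) p
      ≡⟨ pairing-swap (λ k m → coeff (H k m) l) p q ⟩
    pairing (λ m → pairing (λ k → coeff (H k m) l) p) q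
      ≡⟨ pairing-cong (λ m → coeff-extend (λ k → H k m) p l) q ⟨
    pairing (λ m → coeff (extend (λ k → H k m) p) l) q
      ≡⟨ coeff-extend _ q l ⟨
    coeff (extend (λ m → extend (λ k → H k m) p) q) l
      ∎
    where open ≡-Reasoning

extend-single-id : ∀ {{_ : IsDecEquivalence {A = K} _≡_}} (p : FormalSum K) → extend single p ≈ p
extend-single-id p = mk≈ λ k → trans (coeff-extend single p k) (pairing-coeff-single k p)

-- Monoid algebras

module MonoidAlgebra {A : Set} {{_ : IsDecEquivalence {A = A} _≡_}}
                     {_∙_ : A → A → A} {ε : A} (isMonoid : IsMonoid _≡_ _∙_ ε) where

  open IsMonoid isMonoid using (assoc; identityˡ; identityʳ)
  open SetoidReasoning (≈-setoid {K = A})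

  single∙ : A → A → FormalSum A
  single∙ v w = single (v ∙ w)

  infixl 7 _⋆_
  _⋆_ : FormalSum A → FormalSum A → FormalSum A
  p ⋆ q = concatMap (λ { (c , v) → map (λ { (d , w) → (c * d , v ∙ w) }) q }) p

  ⋆-as-extend : ∀ p q → p ⋆ q ≡ extend (λ v → extend (single∙ v) q) p
  ⋆-as-extend []            q = refl
  ⋆-as-extend ((c , v) ∷ p) q = cong₂ _++_ (row q) (⋆-as-extend p q)
    where
    row : ∀ q → map (λ { (d , w) → (c * d , v ∙ w) }) q ≡ c · extend (single∙ v) q
    row []            = refl
    row ((d , w) ∷ q) = cong₂ _∷_ (cong (λ x → (c * x , v ∙ w)) (sym (ℚ.*-identityʳ d))) (row q)

  ⋆-respˡ : ∀ {p p′} q → p ≈ p′ → p ⋆ q ≈ p′ ⋆ q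
  ⋆-respˡ {p} {p′} q p≈p′ = begin
    p ⋆ q                                    ≡⟨ ⋆-as-extend p q ⟩
    extend (λ v → extend (single∙ v) q) p    ≈⟨ extend-resp (λ v → extend (single∙ v) q) p≈p′ ⟩
    extend (λ v → extend (single∙ v) q) p′   ≡⟨ ⋆-as-extend p′ q ⟨
    p′ ⋆ q                                   ∎

  ⋆-respʳ : ∀ p {q q′} → q ≈ q′ → p ⋆ q ≈ p ⋆ q′
  ⋆-respʳ p {q} {q′} q≈q′ = begin
    p ⋆ q                                    ≡⟨ ⋆-as-extend p q ⟩
    extend (λ v → extend (single∙ v) q) p    ≈⟨ extend-cong (λ v → extend-resp (single∙ v) q≈q′) p ⟩
    extend (λ v → extend (single∙ v) q′) p   ≡⟨ ⋆-as-extend p q′ ⟨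
    p ⋆ q′                                   ∎

  ⋆-resp : ∀ {p p′ q q′} → p ≈ p′ → q ≈ q′ → p ⋆ q ≈ p′ ⋆ q′
  ⋆-resp {p′ = p′} {q = q} p≈p′ q≈q′ = ≈-trans (⋆-respˡ q p≈p′) (⋆-respʳ p′ q≈q′)

  ⋆-extendˡ : ∀ (F : K → FormalSum A) p q → extend F p ⋆ q ≈ extend (λ k → F k ⋆ q) p
  ⋆-extendˡ F p q = begin
    extend F p ⋆ q
      ≡⟨ ⋆-as-extend (extend F p) q ⟩
    extend (λ v → extend (single∙ v) q) (extend F p)
      ≈⟨ extend-extend (λ v → extend (single∙ v) q) F p ⟩
    extend (λ k → extend (λ v → extend (single∙ v) q) (F k)) p
      ≈⟨ extend-cong (λ k → ≈-reflexive (sym (⋆-as-extend (F k) q))) p ⟩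
    extend (λ k → F k ⋆ q) p
      ∎

  ⋆-extendʳ : ∀ (F : K → FormalSum A) p q → q ⋆ extend F p ≈ extend (λ k → q ⋆ F k) p
  ⋆-extendʳ F p q = begin
    q ⋆ extend F p
      ≡⟨ ⋆-as-extend q (extend F p) ⟩
    extend (λ v → extend (single∙ v) (extend F p)) q
      ≈⟨ extend-cong (λ v → extend-extend (single∙ v) F p) q ⟩
    extend (λ v → extend (λ k → extend (single∙ v) (F k)) p) q
      ≈⟨ extend-swap (λ v k → extend (single∙ v) (F k)) q p ⟩
    extend (λ k → extend (λ v → extend (single∙ v) (F k)) q) p
      ≈⟨ extend-cong (λ k → ≈-reflexive (sym (⋆-as-extend q (F k)))) p ⟩
    extend (λ k → q ⋆ F k) p
      ∎

  single-⋆ : ∀ v q → single v ⋆ q ≈ extend (single∙ v) q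
  single-⋆ v q =
    ≈-trans (≈-reflexive (⋆-as-extend (single v) q)) (extend-single (λ v → extend (single∙ v) q) v)

  ⋆-single : ∀ p w → p ⋆ single w ≈ extend (λ v → single (v ∙ w)) p
  ⋆-single p w =
    ≈-trans (≈-reflexive (⋆-as-extend p (single w))) (extend-cong (λ v → extend-single (single∙ v) w) p)

  single-⋆-single : ∀ v w → single v ⋆ single w ≈ single (v ∙ w)
  single-⋆-single v w = ≈-trans (single-⋆ v (single w)) (extend-single (single∙ v) w)

  ⋆-identityˡ : ∀ q → single ε ⋆ q ≈ q
  ⋆-identityˡ q = begin
    single ε ⋆ q                     ≈⟨ single-⋆ ε q ⟩
    extend (λ w → single (ε ∙ w)) q  ≈⟨ extend-cong (λ w → ≈-reflexive (cong single (identityˡ w))) q ⟩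
    extend single q                  ≈⟨ extend-single-id q ⟩
    q                                ∎

  ⋆-identityʳ : ∀ p → p ⋆ single ε ≈ p
  ⋆-identityʳ p = begin
    p ⋆ single ε                     ≈⟨ ⋆-single p ε ⟩
    extend (λ v → single (v ∙ ε)) p  ≈⟨ extend-cong (λ v → ≈-reflexive (cong single (identityʳ v))) p ⟩
    extend single p                  ≈⟨ extend-single-id p ⟩
    p                                ∎

  ⋆-assoc : ∀ p q r → (p ⋆ q) ⋆ r ≈ p ⋆ (q ⋆ r)
  ⋆-assoc p q r = begin
    (p ⋆ q) ⋆ r
      ≡⟨ cong (_⋆ r) (⋆-as-extend p q) ⟩
    extend (λ v → extend (single∙ v) q) p ⋆ r
      ≈⟨ ⋆-extendˡ (λ v → extend (single∙ v) q) p r ⟩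
    extend (λ v → extend (single∙ v) q ⋆ r) p
      ≈⟨ extend-cong (λ v → ⋆-extendˡ (single∙ v) q r) p ⟩
    extend (λ v → extend (λ w → single (v ∙ w) ⋆ r) q) p
      ≈⟨ extend-cong (λ v → extend-cong (λ w → single-⋆ (v ∙ w) r) q) p ⟩
    extend (λ v → extend (λ w → extend (λ x → single ((v ∙ w) ∙ x)) r) q) p
      ≈⟨ extend-cong (λ v → extend-cong (λ w → extend-cong (λ x →
           ≈-reflexive (cong single (assoc v w x))) r) q) p ⟩
    extend (λ v → extend (λ w → extend (λ x → single (v ∙ (w ∙ x))) r) q) p
      ≈⟨ extend-cong (λ v → extend-cong (λ w → extend-cong (λ x → single-⋆-single v (w ∙ x)) r) q) p ⟨
    extend (λ v → extend (λ w → extend (λ x → single v ⋆ single (w ∙ x)) r) q) p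
      ≈⟨ extend-cong (λ v → extend-cong (λ w → ⋆-extendʳ (single∙ w) r (single v)) q) p ⟨
    extend (λ v → extend (λ w → single v ⋆ extend (single∙ w) r) q) p
      ≈⟨ extend-cong (λ v → ⋆-extendʳ (λ w → extend (single∙ w) r) q (single v)) p ⟨
    extend (λ v → single v ⋆ extend (λ w → extend (single∙ w) r) q) p
      ≡⟨ cong (λ s → extend (λ v → single v ⋆ s) p) (⋆-as-extend q r) ⟨
    extend (λ v → single v ⋆ (q ⋆ r)) p
      ≈⟨ ⋆-extendˡ single p (q ⋆ r) ⟨
    extend single p ⋆ (q ⋆ r)
      ≈⟨ ⋆-respˡ (q ⋆ r) (extend-single-id p) ⟩
    p ⋆ (q ⋆ r)
      ∎

  ⋆-++ˡ : ∀ p p′ q → (p ++ p′) ⋆ q ≡ p ⋆ q ++ p′ ⋆ q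
  ⋆-++ˡ p p′ q = concatMap-++ _ p p′

  ⋆-++ʳ : ∀ p q q′ → p ⋆ (q ++ q′) ≈ p ⋆ q ++ p ⋆ q′
  ⋆-++ʳ p q q′ = begin
    p ⋆ (q ++ q′)
      ≡⟨ ⋆-as-extend p (q ++ q′) ⟩
    extend (λ v → extend (single∙ v) (q ++ q′)) p
      ≈⟨ extend-cong (λ v → ≈-reflexive (concatMap-++ _ q q′)) p ⟩
    extend (λ v → extend (single∙ v) q ++ extend (single∙ v) q′) p
      ≈⟨ extend-++ᶠ _ _ p ⟩
    extend (λ v → extend (single∙ v) q) p ++ extend (λ v → extend (single∙ v) q′) p
      ≡⟨ cong₂ _++_ (⋆-as-extend p q) (⋆-as-extend p q′) ⟨
    p ⋆ q ++ p ⋆ q′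
      ∎

  ⋆-[]ʳ : ∀ p → p ⋆ [] ≡ []
  ⋆-[]ʳ []            = refl
  ⋆-[]ʳ ((c , v) ∷ p) = ⋆-[]ʳ p

  ⁅_,_⁆ : FormalSum A → FormalSum A → FormalSum A
  ⁅ p , q ⁆ = p ⋆ q ++ (- 1ℚ) · (q ⋆ p)

  ⁅⁆-resp : ∀ {p p′ q q′} → p ≈ p′ → q ≈ q′ → ⁅ p , q ⁆ ≈ ⁅ p′ , q′ ⁆
  ⁅⁆-resp p≈p′ q≈q′ = ++-cong (⋆-resp p≈p′ q≈q′) (·-cong (- 1ℚ) (⋆-resp q≈q′ p≈p′))

  ⁅⁆-extendˡ : ∀ (F : K → FormalSum A) p q → ⁅ extend F p , q ⁆ ≈ extend (λ k → ⁅ F k , q ⁆) p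
  ⁅⁆-extendˡ F p q = begin
    extend F p ⋆ q ++ (- 1ℚ) · (q ⋆ extend F p)
      ≈⟨ ++-cong (⋆-extendˡ F p q) (·-cong (- 1ℚ) (⋆-extendʳ F p q)) ⟩
    extend (λ k → F k ⋆ q) p ++ (- 1ℚ) · extend (λ k → q ⋆ F k) p
      ≈⟨ ++-congʳ (extend (λ k → F k ⋆ q) p) (extend-·ᶠ (- 1ℚ) (λ k → q ⋆ F k) p) ⟨
    extend (λ k → F k ⋆ q) p ++ extend (λ k → (- 1ℚ) · (q ⋆ F k)) p
      ≈⟨ extend-++ᶠ (λ k → F k ⋆ q) (λ k → (- 1ℚ) · (q ⋆ F k)) p ⟨
    extend (λ k → ⁅ F k , q ⁆) p
      ∎

  ⁅⁆-extendʳ : ∀ (F : K → FormalSum A) p q → ⁅ q , extend F p ⁆ ≈ extend (λ k → ⁅ q , F k ⁆) p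
  ⁅⁆-extendʳ F p q = begin
    q ⋆ extend F p ++ (- 1ℚ) · (extend F p ⋆ q)
      ≈⟨ ++-cong (⋆-extendʳ F p q) (·-cong (- 1ℚ) (⋆-extendˡ F p q)) ⟩
    extend (λ k → q ⋆ F k) p ++ (- 1ℚ) · extend (λ k → F k ⋆ q) p
      ≈⟨ ++-congʳ (extend (λ k → q ⋆ F k) p) (extend-·ᶠ (- 1ℚ) (λ k → F k ⋆ q) p) ⟨
    extend (λ k → q ⋆ F k) p ++ extend (λ k → (- 1ℚ) · (F k ⋆ q)) p
      ≈⟨ extend-++ᶠ (λ k → q ⋆ F k) (λ k → (- 1ℚ) · (F k ⋆ q)) p ⟨
    extend (λ k → ⁅ q , F k ⁆) p
      ∎

-- Derivations of ℚ⟨B⟩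

open MonoidAlgebra (++-isMonoid {A = ℕ})

Defs-coeff≡coeff : ∀ p w → Defs.coeff p w ≡ coeff p w
Defs-coeff≡coeff []            w = refl
Defs-coeff≡coeff ((c , v) ∷ p) w with v ≟ w
... | yes _ = cong (c +_) (Defs-coeff≡coeff p w)
... | no  _ = Defs-coeff≡coeff p w

≈ₚ⇒≈ : ∀ {p q} → p ≈ₚ q → p ≈ q
≈ₚ⇒≈ {p} {q} p≈q = mk≈ λ w → trans (sym (Defs-coeff≡coeff p w)) (trans (p≈q w) (Defs-coeff≡coeff q w))

≈⇒≈ₚ : ∀ {p q} → p ≈ q → p ≈ₚ q
≈⇒≈ₚ {p} {q} p≈q w = trans (Defs-coeff≡coeff p w) (trans (coeff-≡ p≈q w) (sym (Defs-coeff≡coeff q w)))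

module _ where
  open SetoidReasoning (≈-setoid {K = Word})

  derWord-cong : ∀ {D D′ : ℕ → Poly} → (∀ i → D i ≈ D′ i) → ∀ v → derWord D v ≈ derWord D′ v
  derWord-cong D≈D′ []      = ≈-refl
  derWord-cong D≈D′ (x ∷ v) =
    ++-cong (⋆-respˡ (mono v) (D≈D′ x)) (⋆-respʳ (letter x) (derWord-cong D≈D′ v))

  derWord-++ : ∀ D v u → derWord D (v ++ u) ≈ derWord D v *ₚ mono u ++ mono v *ₚ derWord D u
  derWord-++ D []      u = ≈-sym (⋆-identityˡ (derWord D u))
  derWord-++ D (x ∷ v) u = begin
    D x *ₚ mono (v ++ u) ++ letter x *ₚ derWord D (v ++ u)
      ≈⟨ ++-cong (⋆-respʳ (D x) (≈-sym (single-⋆-single v u))) (⋆-respʳ (letter x) (derWord-++ D v u)) ⟩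
    D x *ₚ (mono v *ₚ mono u) ++ letter x *ₚ (dv *ₚ mono u ++ mono v *ₚ du)
      ≈⟨ ++-cong (≈-sym (⋆-assoc (D x) (mono v) (mono u))) (⋆-++ʳ (letter x) (dv *ₚ mono u) (mono v *ₚ du)) ⟩
    (D x *ₚ mono v) *ₚ mono u ++ (letter x *ₚ (dv *ₚ mono u) ++ letter x *ₚ (mono v *ₚ du))
      ≈⟨ ++-congʳ ((D x *ₚ mono v) *ₚ mono u)
                  (++-cong (≈-sym (⋆-assoc (letter x) dv (mono u))) (≈-sym (⋆-assoc (letter x) (mono v) du))) ⟩
    (D x *ₚ mono v) *ₚ mono u ++ ((letter x *ₚ dv) *ₚ mono u ++ (letter x *ₚ mono v) *ₚ du)
      ≡⟨ ++-assoc ((D x *ₚ mono v) *ₚ mono u) ((letter x *ₚ dv) *ₚ mono u) ((letter x *ₚ mono v) *ₚ du) ⟨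
    ((D x *ₚ mono v) *ₚ mono u ++ (letter x *ₚ dv) *ₚ mono u) ++ (letter x *ₚ mono v) *ₚ du
      ≈⟨ ++-cong (≈-reflexive (sym (⋆-++ˡ (D x *ₚ mono v) (letter x *ₚ dv) (mono u))))
                 (⋆-respˡ du (single-⋆-single (x ∷ []) v)) ⟩
    derWord D (x ∷ v) *ₚ mono u ++ mono (x ∷ v) *ₚ du
      ∎
    where
    dv = derWord D v
    du = derWord D u

  derPoly-*ₚ : ∀ D p q → derPoly D (p *ₚ q) ≈ derPoly D p *ₚ q ++ p *ₚ derPoly D q
  derPoly-*ₚ D p q = begin
    extend d (p *ₚ q)
      ≡⟨ cong (extend d) (⋆-as-extend p q) ⟩
    extend d (extend (λ v → extend (single∙ v) q) p)
      ≈⟨ extend-extend d (λ v → extend (single∙ v) q) p ⟩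
    extend (λ v → extend d (extend (single∙ v) q)) p
      ≈⟨ extend-cong (λ v → extend-extend d (single∙ v) q) p ⟩
    extend (λ v → extend (λ w → extend d (mono (v ++ w))) q) p
      ≈⟨ extend-cong (λ v → extend-cong (λ w → extend-single d (v ++ w)) q) p ⟩
    extend (λ v → extend (λ w → d (v ++ w)) q) p
      ≈⟨ extend-cong (λ v → extend-cong (λ w → derWord-++ D v w) q) p ⟩
    extend (λ v → extend (λ w → d v *ₚ mono w ++ mono v *ₚ d w) q) p
      ≈⟨ extend-cong (λ v → extend-++ᶠ (λ w → d v *ₚ mono w) (λ w → mono v *ₚ d w) q) p ⟩
    extend (λ v → extend (λ w → d v *ₚ mono w) q ++ extend (λ w → mono v *ₚ d w) q) p
      ≈⟨ extend-++ᶠ _ _ p ⟩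
    extend (λ v → extend (λ w → d v *ₚ mono w) q) p ++ extend (λ v → extend (λ w → mono v *ₚ d w) q) p
      ≈⟨ ++-cong (extend-cong (λ v → ⋆-extendʳ single q (d v)) p)
                 (extend-cong (λ v → ⋆-extendʳ d q (mono v)) p) ⟨
    extend (λ v → d v *ₚ extend single q) p ++ extend (λ v → mono v *ₚ extend d q) p
      ≈⟨ ++-cong (⋆-extendˡ d p (extend single q)) (⋆-extendˡ single p (extend d q)) ⟨
    extend d p *ₚ extend single q ++ extend single p *ₚ extend d q
      ≈⟨ ++-cong (⋆-respʳ (extend d p) (extend-single-id q)) (⋆-respˡ (extend d q) (extend-single-id p)) ⟩
    extend d p *ₚ q ++ p *ₚ extend d q
      ∎
    where d = derWord D

  derPoly-⟦⟧ : ∀ D p q → derPoly D ⟦ p , q ⟧ ≈ ⟦ derPoly D p , q ⟧ ++ ⟦ p , derPoly D q ⟧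
  derPoly-⟦⟧ D p q = begin
    extend d (p *ₚ q ++ (- 1ℚ) · (q *ₚ p))
      ≡⟨ concatMap-++ _ (p *ₚ q) ((- 1ℚ) · (q *ₚ p)) ⟩
    extend d (p *ₚ q) ++ extend d ((- 1ℚ) · (q *ₚ p))
      ≈⟨ ++-cong (derPoly-*ₚ D p q) (≈-trans (extend-· d (- 1ℚ) (q *ₚ p)) (·-cong (- 1ℚ) (derPoly-*ₚ D q p))) ⟩
    (dp *ₚ q ++ p *ₚ dq) ++ (- 1ℚ) · (dq *ₚ p ++ q *ₚ dp)
      ≡⟨ cong ((dp *ₚ q ++ p *ₚ dq) ++_) (map-++ _ (dq *ₚ p) (q *ₚ dp)) ⟩
    (dp *ₚ q ++ p *ₚ dq) ++ ((- 1ℚ) · (dq *ₚ p) ++ (- 1ℚ) · (q *ₚ dp))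
      ≈⟨ ++-congʳ (dp *ₚ q ++ p *ₚ dq) (++-comm ((- 1ℚ) · (dq *ₚ p)) ((- 1ℚ) · (q *ₚ dp))) ⟩
    (dp *ₚ q ++ p *ₚ dq) ++ ((- 1ℚ) · (q *ₚ dp) ++ (- 1ℚ) · (dq *ₚ p))
      ≈⟨ ++-interchange (dp *ₚ q) (p *ₚ dq) ((- 1ℚ) · (q *ₚ dp)) ((- 1ℚ) · (dq *ₚ p)) ⟩
    ⟦ dp , q ⟧ ++ ⟦ p , dq ⟧
      ∎
    where
    d  = derWord D
    dp = extend d p
    dq = extend d q

deriveLie : (ℕ → LieExpr) → LieExpr → LieExpr
deriveLie δ (gen n)    = δ n
deriveLie δ zer        = zer
deriveLie δ (add e f)  = add (deriveLie δ e) (deriveLie δ f)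
deriveLie δ (smul c e) = smul c (deriveLie δ e)
deriveLie δ (br e f)   = add (br (deriveLie δ e) f) (br e (deriveLie δ f))

derPoly-evalL : ∀ D δ → (∀ n → D (suc n) ≈ evalL (δ n)) →
                ∀ e → derPoly D (evalL e) ≈ evalL (deriveLie δ e)
derPoly-evalL D δ Dδ (gen n)    = begin
  derPoly D (letter (suc n))                    ≈⟨ extend-single (derWord D) (suc n ∷ []) ⟩
  D (suc n) *ₚ mono [] ++ letter (suc n) *ₚ []  ≈⟨ ++-cong (⋆-identityʳ (D (suc n)))
                                                           (≈-reflexive (⋆-[]ʳ (letter (suc n)))) ⟩
  D (suc n) ++ []                               ≡⟨ ++-identityʳ (D (suc n)) ⟩
  D (suc n)                                     ≈⟨ Dδ n ⟩
  evalL (δ n)                                   ∎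
  where open SetoidReasoning ≈-setoid
derPoly-evalL D δ Dδ zer        = ≈-refl
derPoly-evalL D δ Dδ (add e f)  = ≈-trans (≈-reflexive (concatMap-++ _ (evalL e) (evalL f)))
                                          (++-cong (derPoly-evalL D δ Dδ e) (derPoly-evalL D δ Dδ f))
derPoly-evalL D δ Dδ (smul c e) = ≈-trans (extend-· (derWord D) c (evalL e)) (·-cong c (derPoly-evalL D δ Dδ e))
derPoly-evalL D δ Dδ (br e f)   = ≈-trans (derPoly-⟦⟧ D (evalL e) (evalL f))
  (++-cong (⁅⁆-resp (derPoly-evalL D δ Dδ e) ≈-refl) (⁅⁆-resp ≈-refl (derPoly-evalL D δ Dδ f)))

∂gens : Poly → ℕ → Poly
∂gens ψ i = extend (λ w → ∂gen w i) ψ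

derWord-extend : ∀ (D : Word → ℕ → Poly) ψ v →
                 derWord (λ i → extend (λ w → D w i) ψ) v ≈ extend (λ w → derWord (D w) v) ψ
derWord-extend D ψ []      = ≈-sym (extend-[]ᶠ ψ)
derWord-extend D ψ (x ∷ v) = begin
  extend (λ w → D w x) ψ *ₚ mono v ++ letter x *ₚ derWord (λ i → extend (λ w → D w i) ψ) v
    ≈⟨ ++-cong (⋆-extendˡ (λ w → D w x) ψ (mono v)) (⋆-respʳ (letter x) (derWord-extend D ψ v)) ⟩
  extend (λ w → D w x *ₚ mono v) ψ ++ letter x *ₚ extend (λ w → derWord (D w) v) ψ
    ≈⟨ ++-congʳ (extend (λ w → D w x *ₚ mono v) ψ) (⋆-extendʳ (λ w → derWord (D w) v) ψ (letter x)) ⟩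
  extend (λ w → D w x *ₚ mono v) ψ ++ extend (λ w → letter x *ₚ derWord (D w) v) ψ
    ≈⟨ extend-++ᶠ (λ w → D w x *ₚ mono v) (λ w → letter x *ₚ derWord (D w) v) ψ ⟨
  extend (λ w → derWord (D w) (x ∷ v)) ψ
    ∎
  where open SetoidReasoning ≈-setoid

∂≈derPoly-∂gens : ∀ ψ x → ∂ ψ x ≈ derPoly (∂gens ψ) x
∂≈derPoly-∂gens ψ x = begin
  extend (λ w → extend (derWord (∂gen w)) x) ψ          ≈⟨ extend-swap (λ w v → derWord (∂gen w) v) ψ x ⟩
  extend (λ v → extend (λ w → derWord (∂gen w) v) ψ) x  ≈⟨ extend-cong (derWord-extend ∂gen ψ) x ⟨
  extend (derWord (∂gens ψ)) x                          ∎
  where open SetoidReasoning ≈-setoid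

-- The homomorphism Φ : ℚ⟨B⟩ → ℚ⟨B⟩[t]

-- (a , w) is the monomial t^a w.
Graded : Set
Graded = ℕ × Word

_∙ᵍ_ : Graded → Graded → Graded
(a , v) ∙ᵍ (b , w) = (a ℕ.+ b , v ++ w)

graded-isMonoid : IsMonoid _≡_ _∙ᵍ_ (0 , [])
graded-isMonoid = record
  { isSemigroup = record
    { isMagma = record { isEquivalence = isEquivalence ; ∙-cong = cong₂ _∙ᵍ_ }
    ; assoc   = λ { (a , u) (b , v) (c , w) → cong₂ _,_ (ℕ.+-assoc a b c) (++-assoc u v w) }
    }
  ; identity = (λ _ → refl) , λ { (a , v) → cong₂ _,_ (ℕ.+-identityʳ a) (++-identityʳ v) }
  }

module Graded = MonoidAlgebra graded-isMonoid
open Graded using () renaming (_⋆_ to _⋆ᵍ_; ⁅_,_⁆ to ⁅_,_⁆ᵍ)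

inDegree : ℕ → Poly → FormalSum Graded
inDegree a = extend (λ w → single (a , w))

letterCoeff : ℕ → ℕ → ℚ
letterCoeff k l = sign (k ∸ l) * ℕtoℚ (k C l)

letterImage : ℕ → FormalSum Graded
letterImage zero    = single (0 , zero ∷ [])
letterImage (suc k) = map (λ l → (letterCoeff k l , (k ∸ l , suc l ∷ []))) (upTo (suc k))

Φ : Poly → FormalSum Graded
Φ = extend subs

subs-∷ : ∀ x w → subs (x ∷ w) ≈ letterImage x ⋆ᵍ subs w
subs-∷ zero    w = ≈-reflexive (trans
  (map-cong (λ { (d , u) → cong (_, (0 , zero ∷ []) ∙ᵍ u) (sym (ℚ.*-identityˡ d)) }) (subs w))
  (sym (++-identityʳ _)))
subs-∷ (suc k) w = ≈-reflexive (rows (upTo (suc k)))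
  where
  row : ℕ → FormalSum Graded
  row l = map (λ { (d , u) → (letterCoeff k l * d , (k ∸ l , suc l ∷ []) ∙ᵍ u) }) (subs w)

  rows : ∀ ls → concatMap row ls ≡ map (λ l → (letterCoeff k l , (k ∸ l , suc l ∷ []))) ls ⋆ᵍ subs w
  rows []       = refl
  rows (l ∷ ls) = cong (row l ++_) (rows ls)

module _ where
  open SetoidReasoning (≈-setoid {K = Graded})

  subs-++ : ∀ v w → subs (v ++ w) ≈ subs v ⋆ᵍ subs w
  subs-++ []      w = ≈-sym (Graded.⋆-identityˡ (subs w))
  subs-++ (x ∷ v) w = begin
    subs (x ∷ v ++ w)                    ≈⟨ subs-∷ x (v ++ w) ⟩
    letterImage x ⋆ᵍ subs (v ++ w)       ≈⟨ Graded.⋆-respʳ (letterImage x) (subs-++ v w) ⟩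
    letterImage x ⋆ᵍ (subs v ⋆ᵍ subs w)  ≈⟨ Graded.⋆-assoc (letterImage x) (subs v) (subs w) ⟨
    (letterImage x ⋆ᵍ subs v) ⋆ᵍ subs w  ≈⟨ Graded.⋆-respˡ (subs w) (subs-∷ x v) ⟨
    subs (x ∷ v) ⋆ᵍ subs w               ∎

  Φ-*ₚ : ∀ p q → Φ (p *ₚ q) ≈ Φ p ⋆ᵍ Φ q
  Φ-*ₚ p q = begin
    Φ (p *ₚ q)
      ≡⟨ cong Φ (⋆-as-extend p q) ⟩
    Φ (extend (λ v → extend (single∙ v) q) p)
      ≈⟨ extend-extend subs (λ v → extend (single∙ v) q) p ⟩
    extend (λ v → Φ (extend (single∙ v) q)) p
      ≈⟨ extend-cong (λ v → extend-extend subs (single∙ v) q) p ⟩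
    extend (λ v → extend (λ w → Φ (mono (v ++ w))) q) p
      ≈⟨ extend-cong (λ v → extend-cong (λ w → extend-single subs (v ++ w)) q) p ⟩
    extend (λ v → extend (λ w → subs (v ++ w)) q) p
      ≈⟨ extend-cong (λ v → extend-cong (subs-++ v) q) p ⟩
    extend (λ v → extend (λ w → subs v ⋆ᵍ subs w) q) p
      ≈⟨ extend-cong (λ v → Graded.⋆-extendʳ subs q (subs v)) p ⟨
    extend (λ v → subs v ⋆ᵍ Φ q) p
      ≈⟨ Graded.⋆-extendˡ subs p (Φ q) ⟨
    Φ p ⋆ᵍ Φ q
      ∎

  Φ-⟦⟧ : ∀ p q → Φ ⟦ p , q ⟧ ≈ ⁅ Φ p , Φ q ⁆ᵍ
  Φ-⟦⟧ p q = begin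
    Φ (p *ₚ q ++ (- 1ℚ) · (q *ₚ p))      ≡⟨ concatMap-++ _ (p *ₚ q) ((- 1ℚ) · (q *ₚ p)) ⟩
    Φ (p *ₚ q) ++ Φ ((- 1ℚ) · (q *ₚ p))  ≈⟨ ++-cong (Φ-*ₚ p q)
                                              (≈-trans (extend-· subs (- 1ℚ) (q *ₚ p)) (·-cong (- 1ℚ) (Φ-*ₚ q p))) ⟩
    ⁅ Φ p , Φ q ⁆ᵍ                       ∎

  inDegree-⋆ : ∀ a b p q → inDegree a p ⋆ᵍ inDegree b q ≈ inDegree (a ℕ.+ b) (p *ₚ q)
  inDegree-⋆ a b p q = begin
    inDegree a p ⋆ᵍ inDegree b q
      ≈⟨ Graded.⋆-extendˡ (λ v → single (a , v)) p (inDegree b q) ⟩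
    extend (λ v → single (a , v) ⋆ᵍ inDegree b q) p
      ≈⟨ extend-cong (λ v → Graded.⋆-extendʳ (λ w → single (b , w)) q (single (a , v))) p ⟩
    extend (λ v → extend (λ w → single (a , v) ⋆ᵍ single (b , w)) q) p
      ≈⟨ extend-cong (λ v → extend-cong (λ w → Graded.single-⋆-single (a , v) (b , w)) q) p ⟩
    extend (λ v → extend (λ w → single (a ℕ.+ b , v ++ w)) q) p
      ≈⟨ extend-cong (λ v → extend-cong (λ w → extend-single (λ u → single (a ℕ.+ b , u)) (v ++ w)) q) p ⟨
    extend (λ v → extend (λ w → inDegree (a ℕ.+ b) (mono (v ++ w))) q) p
      ≈⟨ extend-cong (λ v → extend-extend (λ u → single (a ℕ.+ b , u)) (single∙ v) q) p ⟨
    extend (λ v → inDegree (a ℕ.+ b) (extend (single∙ v) q)) p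
      ≈⟨ extend-extend (λ u → single (a ℕ.+ b , u)) (λ v → extend (single∙ v) q) p ⟨
    inDegree (a ℕ.+ b) (extend (λ v → extend (single∙ v) q) p)
      ≡⟨ cong (inDegree (a ℕ.+ b)) (⋆-as-extend p q) ⟨
    inDegree (a ℕ.+ b) (p *ₚ q)
      ∎

  inDegree-⟦⟧ : ∀ a b p q → ⁅ inDegree a p , inDegree b q ⁆ᵍ ≈ inDegree (a ℕ.+ b) ⟦ p , q ⟧
  inDegree-⟦⟧ a b p q = begin
    inDegree a p ⋆ᵍ inDegree b q ++ (- 1ℚ) · (inDegree b q ⋆ᵍ inDegree a p)
      ≈⟨ ++-cong (inDegree-⋆ a b p q) (·-cong (- 1ℚ) (inDegree-⋆ b a q p)) ⟩
    inDegree (a ℕ.+ b) (p *ₚ q) ++ (- 1ℚ) · inDegree (b ℕ.+ a) (q *ₚ p)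
      ≡⟨ cong (λ c → inDegree (a ℕ.+ b) (p *ₚ q) ++ (- 1ℚ) · inDegree c (q *ₚ p)) (ℕ.+-comm b a) ⟩
    inDegree (a ℕ.+ b) (p *ₚ q) ++ (- 1ℚ) · inDegree (a ℕ.+ b) (q *ₚ p)
      ≈⟨ ++-congʳ (inDegree (a ℕ.+ b) (p *ₚ q)) (extend-· (λ w → single (a ℕ.+ b , w)) (- 1ℚ) (q *ₚ p)) ⟨
    inDegree (a ℕ.+ b) (p *ₚ q) ++ inDegree (a ℕ.+ b) ((- 1ℚ) · (q *ₚ p))
      ≡⟨ concatMap-++ _ (p *ₚ q) ((- 1ℚ) · (q *ₚ p)) ⟨
    inDegree (a ℕ.+ b) ⟦ p , q ⟧
      ∎

GradedLie : Set
GradedLie = FormalSum (ℕ × LieExpr)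

evalTerm : ℕ × LieExpr → FormalSum Graded
evalTerm (a , e) = inDegree a (evalL e)

evalG : GradedLie → FormalSum Graded
evalG = extend evalTerm

brTerm : ℕ × LieExpr → ℕ × LieExpr → ℕ × LieExpr
brTerm (a , e) (b , f) = (a ℕ.+ b , br e f)

⁅_,_⁆ᴸ : GradedLie → GradedLie → GradedLie
⁅ g , h ⁆ᴸ = extend (λ x → extend (λ y → single (brTerm x y)) h) g

ΦLie : LieExpr → GradedLie
ΦLie (gen k)    = map (λ l → (letterCoeff k l , (k ∸ l , gen l))) (upTo (suc k))
ΦLie zer        = []
ΦLie (add e f)  = ΦLie e ++ ΦLie f
ΦLie (smul c e) = c · ΦLie e
ΦLie (br e f)   = ⁅ ΦLie e , ΦLie f ⁆ᴸ

module _ where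
  open SetoidReasoning (≈-setoid {K = Graded})

  evalTerm-brTerm : ∀ x y → ⁅ evalTerm x , evalTerm y ⁆ᵍ ≈ evalTerm (brTerm x y)
  evalTerm-brTerm (a , e) (b , f) = inDegree-⟦⟧ a b (evalL e) (evalL f)

  evalG-⁅⁆ᴸ : ∀ g h → evalG ⁅ g , h ⁆ᴸ ≈ ⁅ evalG g , evalG h ⁆ᵍ
  evalG-⁅⁆ᴸ g h = begin
    evalG (extend (λ x → extend (λ y → single (brTerm x y)) h) g)
      ≈⟨ extend-extend evalTerm (λ x → extend (λ y → single (brTerm x y)) h) g ⟩
    extend (λ x → evalG (extend (λ y → single (brTerm x y)) h)) g
      ≈⟨ extend-cong (λ x → extend-extend evalTerm (λ y → single (brTerm x y)) h) g ⟩
    extend (λ x → extend (λ y → evalG (single (brTerm x y))) h) g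
      ≈⟨ extend-cong (λ x → extend-cong (λ y → extend-single evalTerm (brTerm x y)) h) g ⟩
    extend (λ x → extend (λ y → evalTerm (brTerm x y)) h) g
      ≈⟨ extend-cong (λ x → extend-cong (evalTerm-brTerm x) h) g ⟨
    extend (λ x → extend (λ y → ⁅ evalTerm x , evalTerm y ⁆ᵍ) h) g
      ≈⟨ extend-cong (λ x → Graded.⁅⁆-extendʳ evalTerm h (evalTerm x)) g ⟨
    extend (λ x → ⁅ evalTerm x , evalG h ⁆ᵍ) g
      ≈⟨ Graded.⁅⁆-extendˡ evalTerm g (evalG h) ⟨
    ⁅ evalG g , evalG h ⁆ᵍ
      ∎

  evalG-ΦLie-gen : ∀ k → evalG (ΦLie (gen k)) ≡ letterImage (suc k)
  evalG-ΦLie-gen k = terms (upTo (suc k))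
    where
    terms : ∀ ls → evalG (map (λ l → (letterCoeff k l , (k ∸ l , gen l))) ls)
                 ≡ map (λ l → (letterCoeff k l , (k ∸ l , suc l ∷ []))) ls
    terms []       = refl
    terms (l ∷ ls) = cong₂ _∷_
      (cong (_, (k ∸ l , suc l ∷ [])) (trans (cong (letterCoeff k l *_) (ℚ.*-identityˡ 1ℚ)) (ℚ.*-identityʳ _)))
      (terms ls)

  Φ-evalL : ∀ e → Φ (evalL e) ≈ evalG (ΦLie e)
  Φ-evalL (gen k)    = begin
    Φ (letter (suc k))                      ≈⟨ extend-single subs (suc k ∷ []) ⟩
    subs (suc k ∷ [])                       ≈⟨ subs-∷ (suc k) [] ⟩
    letterImage (suc k) ⋆ᵍ single (0 , [])  ≈⟨ Graded.⋆-identityʳ (letterImage (suc k)) ⟩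
    letterImage (suc k)                     ≡⟨ evalG-ΦLie-gen k ⟨
    evalG (ΦLie (gen k))                    ∎
  Φ-evalL zer        = ≈-refl
  Φ-evalL (add e f)  = begin
    Φ (evalL e ++ evalL f)            ≡⟨ concatMap-++ _ (evalL e) (evalL f) ⟩
    Φ (evalL e) ++ Φ (evalL f)        ≈⟨ ++-cong (Φ-evalL e) (Φ-evalL f) ⟩
    evalG (ΦLie e) ++ evalG (ΦLie f)  ≡⟨ concatMap-++ _ (ΦLie e) (ΦLie f) ⟨
    evalG (ΦLie e ++ ΦLie f)          ∎
  Φ-evalL (smul c e) = begin
    Φ (c · evalL e)     ≈⟨ extend-· subs c (evalL e) ⟩
    c · Φ (evalL e)     ≈⟨ ·-cong c (Φ-evalL e) ⟩
    c · evalG (ΦLie e)  ≈⟨ extend-· evalTerm c (ΦLie e) ⟨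
    evalG (c · ΦLie e)  ∎
  Φ-evalL (br e f)   = begin
    Φ ⟦ evalL e , evalL f ⟧               ≈⟨ Φ-⟦⟧ (evalL e) (evalL f) ⟩
    ⁅ Φ (evalL e) , Φ (evalL f) ⁆ᵍ        ≈⟨ Graded.⁅⁆-resp (Φ-evalL e) (Φ-evalL f) ⟩
    ⁅ evalG (ΦLie e) , evalG (ΦLie f) ⁆ᵍ  ≈⟨ evalG-⁅⁆ᴸ (ΦLie e) (ΦLie f) ⟨
    evalG ⁅ ΦLie e , ΦLie f ⁆ᴸ            ∎

-- The derivations ∂_ψ

adShift : ℕ → Graded → Poly
adShift n (δ , v) = ⟦ letter (suc n ℕ.+ δ) , mono v ⟧

adShiftLie : ℕ → GradedLie → LieExpr
adShiftLie n []                = zer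
adShiftLie n ((c , δ , e) ∷ g) = add (smul c (br (gen (n ℕ.+ δ)) e)) (adShiftLie n g)

module _ where
  open SetoidReasoning (≈-setoid {K = Word})

  ∂gens-Φ : ∀ ψ n → ∂gens ψ (suc n) ≈ extend (adShift n) (Φ ψ)
  ∂gens-Φ ψ n = ≈-sym (extend-extend (adShift n) subs ψ)

  adShift-inDegree : ∀ n δ p → extend (adShift n) (inDegree δ p) ≈ ⟦ letter (suc n ℕ.+ δ) , p ⟧
  adShift-inDegree n δ p = begin
    extend (adShift n) (inDegree δ p)
      ≈⟨ extend-extend (adShift n) (λ w → single (δ , w)) p ⟩
    extend (λ w → extend (adShift n) (single (δ , w))) p
      ≈⟨ extend-cong (λ w → extend-single (adShift n) (δ , w)) p ⟩
    extend (λ w → ⟦ b , mono w ⟧) p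
      ≈⟨ ⁅⁆-extendʳ single p b ⟨
    ⟦ b , extend single p ⟧
      ≈⟨ ⁅⁆-resp ≈-refl (extend-single-id p) ⟩
    ⟦ b , p ⟧
      ∎
    where b = letter (suc n ℕ.+ δ)

  adShift-evalG : ∀ n g → extend (adShift n) (evalG g) ≈ evalL (adShiftLie n g)
  adShift-evalG n []                = ≈-refl
  adShift-evalG n ((c , δ , e) ∷ g) = begin
    extend (adShift n) (c · inDegree δ (evalL e) ++ evalG g)
      ≡⟨ concatMap-++ _ (c · inDegree δ (evalL e)) (evalG g) ⟩
    extend (adShift n) (c · inDegree δ (evalL e)) ++ extend (adShift n) (evalG g)
      ≈⟨ ++-cong (≈-trans (extend-· (adShift n) c (inDegree δ (evalL e))) (·-cong c (adShift-inDegree n δ (evalL e))))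
                 (adShift-evalG n g) ⟩
    c · ⟦ letter (suc n ℕ.+ δ) , evalL e ⟧ ++ evalL (adShiftLie n g)
      ∎

  ∂gens-evalL : ∀ e n → ∂gens (evalL e) (suc n) ≈ evalL (adShiftLie n (ΦLie e))
  ∂gens-evalL e n = begin
    ∂gens (evalL e) (suc n)              ≈⟨ ∂gens-Φ (evalL e) n ⟩
    extend (adShift n) (Φ (evalL e))     ≈⟨ extend-resp (adShift n) (Φ-evalL e) ⟩
    extend (adShift n) (evalG (ΦLie e))  ≈⟨ adShift-evalG n (ΦLie e) ⟩
    evalL (adShiftLie n (ΦLie e))        ∎

∂Lie : LieExpr → LieExpr → LieExpr
∂Lie e₁ = deriveLie (λ n → adShiftLie n (ΦLie e₁))

evalL-∂Lie : ∀ e₁ e₂ {ψ₁ ψ₂} → evalL e₁ ≈ ψ₁ → evalL e₂ ≈ ψ₂ → evalL (∂Lie e₁ e₂) ≈ ∂ ψ₁ ψ₂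
evalL-∂Lie e₁ e₂ {ψ₁} {ψ₂} e₁≈ψ₁ e₂≈ψ₂ = begin
  evalL (∂Lie e₁ e₂)
    ≈⟨ derPoly-evalL (∂gens (evalL e₁)) _ (∂gens-evalL e₁) e₂ ⟨
  derPoly (∂gens (evalL e₁)) (evalL e₂)
    ≈⟨ extend-resp (derWord (∂gens (evalL e₁))) e₂≈ψ₂ ⟩
  derPoly (∂gens (evalL e₁)) ψ₂
    ≈⟨ extend-cong (derWord-cong (λ i → extend-resp (λ w → ∂gen w i) e₁≈ψ₁)) ψ₂ ⟩
  derPoly (∂gens ψ₁) ψ₂
    ≈⟨ ∂≈derPoly-∂gens ψ₁ ψ₂ ⟨
  ∂ ψ₁ ψ₂
    ∎
  where open SetoidReasoning ≈-setoid

lemma2p3 : (ψ₁ ψ₂ : Poly) → InLie⁺ ψ₁ → InLie⁺ ψ₂ → InLie⁺ (bracketA ψ₁ ψ₂)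
lemma2p3 ψ₁ ψ₂ (e₁ , e₁≈ₚψ₁) (e₂ , e₂≈ₚψ₂) =
  add (add (∂Lie e₁ e₂) (smul (- 1ℚ) (∂Lie e₂ e₁))) (br e₁ e₂) ,
  ≈⇒≈ₚ (++-cong (++-cong (evalL-∂Lie e₁ e₂ e₁≈ψ₁ e₂≈ψ₂)
                         (·-cong (- 1ℚ) (evalL-∂Lie e₂ e₁ e₂≈ψ₂ e₁≈ψ₁)))
                (⁅⁆-resp e₁≈ψ₁ e₂≈ψ₂))
  where
  e₁≈ψ₁ : evalL e₁ ≈ ψ₁
  e₁≈ψ₁ = ≈ₚ⇒≈ e₁≈ₚψ₁
  e₂≈ψ₂ : evalL e₂ ≈ ψ₂
  e₂≈ψ₂ = ≈ₚ⇒≈ e₂≈ₚψ₂
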